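{- A closed $\lambda\mathrm{Y}$ term $M:\sigma$ is $\lambda\mathrm{Y}$-convertible to a (long) normal form of the pure typed $\lambda\beta\eta$-calculus if and only if $t_\sigma(\mathcal{O}[\![M]\!])=\top$.
   Context: Simple types are built from a ground type $o$ with $\to$; write $\sigma_1\to\cdots\to\sigma_n\to o$ as $(\sigma_1,\ldots,\sigma_n)$. The $\lambda\mathrm{Y}$-calculus is the typed (Church-style) $\lambda\beta\eta$-calculus extended with constants $\mathrm{Y}_\sigma:(\sigma\to\sigma)\to\sigma$ and conversions $f(\mathrm{Y}_\sigma f)=\mathrm{Y}_\sigma f$. Semantics: $\mathcal{O}_o=\{\perp,\top\}$ with $\perp\le\top$, $\mathcal{O}_{\sigma\to\tau}$ the finite poset of monotone maps ordered pointwise; terms are interpreted in the standard way, with $\mathcal{O}[\![\mathrm{Y}_\sigma]\!]$ the least fixed point operator $f\mapsto\bigvee_n f^n(\perp_{\mathcal{O}_\sigma})$. Test functions $t_\sigma:\mathcal{O}_\sigma\to\mathcal{O}_o$ and elements $s_\sigma\in\mathcal{O}_\sigma$ are defined by mutual induction: for $\sigma=(\sigma_1,\ldots,\sigma_n)$, $t_\sigma(f)=f\,s_{\sigma_1}\cdots s_{\sigma_n}$ and $s_\sigma f_1\ldots f_n=\bigwedge_i t_{\sigma_i}(f_i)$ (so $t_o(x)=x$, $s_o=\top$). -}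

module Defs where

open import Data.Bool using (Bool; true; false; _∧_)
open import Data.Nat using (ℕ; zero; suc; _*_; _^_)
open import Data.List using (List; []; _∷_)
open import Data.Product using (Σ; _,_; proj₁; proj₂)

infixr 7 _⇒_
data Ty : Set where
  o   : Ty
  _⇒_ : Ty → Ty → Ty

-- Semantics: O_o = {⊥ ≤ ⊤} (false ≤ true), O_{σ⇒τ} = monotone maps,
-- ordered pointwise.

data _≤B_ : Bool → Bool → Set where
  f≤  : ∀ {b} → false ≤B b
  t≤t : true ≤B true

mutual
  O : Ty → Set
  O o       = Bool
  O (σ ⇒ τ) = Σ (O σ → O τ) (λ f → ∀ {x y} → Le σ x y → Le τ (f x) (f y))

  Le : (σ : Ty) → O σ → O σ → Set
  Le o x y       = x ≤B y
  Le (σ ⇒ τ) f g = ∀ x → Le τ (proj₁ f x) (proj₁ g x)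

Le-refl : ∀ σ (x : O σ) → Le σ x x
Le-refl o false = f≤
Le-refl o true  = t≤t
Le-refl (σ ⇒ τ) f x = Le-refl τ (proj₁ f x)

Le-trans : ∀ σ {x y z : O σ} → Le σ x y → Le σ y z → Le σ x z
Le-trans o f≤ q = f≤
Le-trans o t≤t t≤t = t≤t
Le-trans (σ ⇒ τ) p q x = Le-trans τ (p x) (q x)

bot : ∀ σ → O σ
bot o       = false
bot (σ ⇒ τ) = (λ _ → bot τ) , λ _ → Le-refl τ (bot τ)

iter : ∀ σ → ℕ → O (σ ⇒ σ) → O σ
iter σ zero    f = bot σ
iter σ (suc n) f = proj₁ f (iter σ n f)

iter-mono : ∀ σ n {f g : O (σ ⇒ σ)} → Le (σ ⇒ σ) f g → Le σ (iter σ n f) (iter σ n g)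
iter-mono σ zero    p = Le-refl σ (bot σ)
iter-mono σ (suc n) {f} {g} p =
  Le-trans σ (proj₂ f (iter-mono σ n p)) (p (iter σ n g))

-- Upper bound on the cardinality of O σ, and on the length of strictly
-- increasing chains in O σ (pointwise order).
card : Ty → ℕ
card o       = 2
card (σ ⇒ τ) = card τ ^ card σ

height : Ty → ℕ
height o       = 1
height (σ ⇒ τ) = card σ * height τ

-- Least fixed point operator  f ↦ ⋁ₙ fⁿ(⊥).  Since O σ is finite, the
-- increasing chain fⁿ(⊥) is stationary from n = height σ on, so its join
-- is f^(height σ)(⊥).
lfp : ∀ σ → O ((σ ⇒ σ) ⇒ σ)
lfp σ = (λ f → iter σ (height σ) f) , λ p → iter-mono σ (height σ) p

Ctx : Set
Ctx = List Ty

infix 4 _∋_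
data _∋_ : Ctx → Ty → Set where
  Z : ∀ {Γ σ} → (σ ∷ Γ) ∋ σ
  S : ∀ {Γ σ τ} → Γ ∋ σ → (τ ∷ Γ) ∋ σ

data Tm (Γ : Ctx) : Ty → Set where
  var : ∀ {σ} → Γ ∋ σ → Tm Γ σ
  lam : ∀ {σ τ} → Tm (σ ∷ Γ) τ → Tm Γ (σ ⇒ τ)
  app : ∀ {σ τ} → Tm Γ (σ ⇒ τ) → Tm Γ σ → Tm Γ τ
  Y   : ∀ σ → Tm Γ ((σ ⇒ σ) ⇒ σ)

Ren : Ctx → Ctx → Set
Ren Γ Δ = ∀ {σ} → Γ ∋ σ → Δ ∋ σ

Sub : Ctx → Ctx → Set
Sub Γ Δ = ∀ {σ} → Γ ∋ σ → Tm Δ σ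

ext : ∀ {Γ Δ τ} → Ren Γ Δ → Ren (τ ∷ Γ) (τ ∷ Δ)
ext r Z     = Z
ext r (S x) = S (r x)

rename : ∀ {Γ Δ σ} → Ren Γ Δ → Tm Γ σ → Tm Δ σ
rename r (var x)   = var (r x)
rename r (lam M)   = lam (rename (ext r) M)
rename r (app M N) = app (rename r M) (rename r N)
rename r (Y σ)     = Y σ

exts : ∀ {Γ Δ τ} → Sub Γ Δ → Sub (τ ∷ Γ) (τ ∷ Δ)
exts s Z     = var Z
exts s (S x) = rename S (s x)

subst : ∀ {Γ Δ σ} → Sub Γ Δ → Tm Γ σ → Tm Δ σ
subst s (var x)   = s x
subst s (lam M)   = lam (subst (exts s) M)
subst s (app M N) = app (subst s M) (subst s N)
subst s (Y σ)     = Y σ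

wk : ∀ {Γ σ τ} → Tm Γ σ → Tm (τ ∷ Γ) σ
wk = rename S

single : ∀ {Γ σ} → Tm Γ σ → Sub (σ ∷ Γ) Γ
single N Z     = N
single N (S x) = var x

_[_] : ∀ {Γ σ τ} → Tm (σ ∷ Γ) τ → Tm Γ σ → Tm Γ τ
M [ N ] = subst (single N) M

infix 4 _≈_
data _≈_ {Γ : Ctx} : ∀ {σ} → Tm Γ σ → Tm Γ σ → Set where
  β       : ∀ {σ τ} {M : Tm (σ ∷ Γ) τ} {N : Tm Γ σ} → app (lam M) N ≈ M [ N ]
  η       : ∀ {σ τ} {M : Tm Γ (σ ⇒ τ)} → lam (app (wk M) (var Z)) ≈ M
  Yconv   : ∀ {σ} {f : Tm Γ (σ ⇒ σ)} → app f (app (Y σ) f) ≈ app (Y σ) f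
  ≈-refl  : ∀ {σ} {M : Tm Γ σ} → M ≈ M
  ≈-sym   : ∀ {σ} {M N : Tm Γ σ} → M ≈ N → N ≈ M
  ≈-trans : ∀ {σ} {M N P : Tm Γ σ} → M ≈ N → N ≈ P → M ≈ P
  ≈-lam   : ∀ {σ τ} {M N : Tm (σ ∷ Γ) τ} → M ≈ N → lam M ≈ lam N
  ≈-app   : ∀ {σ τ} {M M' : Tm Γ (σ ⇒ τ)} {N N' : Tm Γ σ} →
            M ≈ M' → N ≈ N' → app M N ≈ app M' N'

-- Long (β-normal, η-long) normal forms of the pure λβη-calculus
-- (no occurrence of Y).

mutual
  data Nf {Γ : Ctx} : ∀ {σ} → Tm Γ σ → Set where
    nf-lam : ∀ {σ τ} {M : Tm (σ ∷ Γ) τ} → Nf M → Nf (lam M)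
    nf-ne  : {M : Tm Γ o} → Ne M → Nf M

  data Ne {Γ : Ctx} : ∀ {σ} → Tm Γ σ → Set where
    ne-var : ∀ {σ} {x : Γ ∋ σ} → Ne (var x)
    ne-app : ∀ {σ τ} {M : Tm Γ (σ ⇒ τ)} {N : Tm Γ σ} → Ne M → Nf N → Ne (app M N)

Env : Ctx → Set
Env Γ = ∀ {σ} → Γ ∋ σ → O σ

LeEnv : ∀ {Γ} → Env Γ → Env Γ → Set
LeEnv {Γ} ρ ρ' = ∀ {σ} (x : Γ ∋ σ) → Le σ (ρ x) (ρ' x)

extend : ∀ {Γ σ} → Env Γ → O σ → Env (σ ∷ Γ)
extend ρ d Z     = d
extend ρ d (S x) = ρ x

extend-le : ∀ {Γ σ} {ρ ρ' : Env Γ} {d d' : O σ} →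
            LeEnv ρ ρ' → Le σ d d' → LeEnv (extend ρ d) (extend ρ' d')
extend-le p q Z     = q
extend-le p q (S x) = p x

emptyEnv : Env []
emptyEnv ()

mutual
  ⟦_⟧ : ∀ {Γ σ} → Tm Γ σ → Env Γ → O σ
  ⟦ var x ⟧   ρ = ρ x
  ⟦ lam {σ} M ⟧ ρ = (λ d → ⟦ M ⟧ (extend ρ d)) ,
                    λ p → ⟦⟧-mono M (extend-le (λ x → Le-refl _ (ρ x)) p)
  ⟦ app M N ⟧ ρ = proj₁ (⟦ M ⟧ ρ) (⟦ N ⟧ ρ)
  ⟦ Y σ ⟧     ρ = lfp σ

  ⟦⟧-mono : ∀ {Γ σ} (M : Tm Γ σ) {ρ ρ' : Env Γ} → LeEnv ρ ρ' →
            Le σ (⟦ M ⟧ ρ) (⟦ M ⟧ ρ')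
  ⟦⟧-mono (var x) p = p x
  ⟦⟧-mono (lam {σ} M) p d = ⟦⟧-mono M (extend-le p (Le-refl σ d))
  ⟦⟧-mono (app {τ = τ} M N) {ρ} {ρ'} p =
    Le-trans τ (proj₂ (⟦ M ⟧ ρ) (⟦⟧-mono N p)) (⟦⟧-mono M p (⟦ N ⟧ ρ'))
  ⟦⟧-mono (Y σ) p = Le-refl _ (lfp σ)

-- Test functions t_σ and elements s_σ.
-- t_{σ⇒τ}(f) = t_τ (f s_σ),  t_o(x) = x,
-- s_o = ⊤,  s_{σ⇒τ} f = t_σ(f) ∧ s_τ   (meet with a constant, pointwise),
-- i.e. s_σ f₁ … fₙ = ⋀ᵢ t_{σᵢ}(fᵢ).

mutual
  meet : ∀ τ → Bool → O τ → O τ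
  meet o b y       = b ∧ y
  meet (σ ⇒ τ) b f = (λ x → meet τ b (proj₁ f x)) ,
                     λ p → meet-mono τ (Le-refl o b) (proj₂ f p)

  meet-mono : ∀ τ {b c : Bool} {x y : O τ} → b ≤B c → Le τ x y →
              Le τ (meet τ b x) (meet τ c y)
  meet-mono o f≤ q = f≤
  meet-mono o t≤t q = q
  meet-mono (σ ⇒ τ) pb q x = meet-mono τ pb (q x)

mutual
  t : ∀ σ → O σ → Bool
  t o x       = x
  t (σ ⇒ τ) f = t τ (proj₁ f (s σ))

  s : ∀ σ → O σ
  s o       = true
  s (σ ⇒ τ) = (λ x → meet τ (t σ x) (s τ)) ,
              λ p → meet-mono τ (t-mono σ p) (Le-refl τ (s τ))

  t-mono : ∀ σ {x y : O σ} → Le σ x y → t σ x ≤B t σ y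
  t-mono o p       = p
  t-mono (σ ⇒ τ) p = t-mono τ (p (s σ))

{-# OPTIONS --safe #-}
module Submission where

-- Soundness: conversion preserves denotations (β and η by the semantic
-- substitution lemma, Y f = f (Y f) because the Kleene chain fⁿ(⊥) in the
-- finite domain O σ is stationary from height σ on, as a rank function
-- summing over representatives of O σ shows), normal forms denote elements
-- above s_σ, and t_σ(d) = ⊤ exactly when s_σ ≤ d.
-- Completeness: a Kripke logical relation M ⊩ d, which at ground type says
-- that d = ⊤ forces M to have a normal form. Every neutral term is related
-- to s_σ and every term related to some d with t_σ(d) = ⊤ has a normal form
-- (reflection and reification), and every term is related to its
-- denotation (fundamental lemma), which for Y relies on ⊩ being closed
-- under the iterates fⁿ(⊥).

open import Defs
open import Data.Bool using (Bool; true; false)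
open import Data.Empty using (⊥-elim)
open import Data.Fin using (Fin; zero; suc; finToFun; funToFin)
open import Data.Fin.Properties using (all?; finToFun-funToFin)
open import Data.List using ([]; _∷_)
open import Data.Nat using (ℕ; zero; suc; _*_; _≤_; _<_; z≤n; +-0-rawMonoid)
open import Algebra.Definitions.RawMonoid +-0-rawMonoid using (sum)
open import Data.Nat.Properties
  using (≤-refl; ≤-<-trans; +-mono-≤; +-mono-<-≤; +-mono-≤-<; <⇒≢; <⇒≱; m≤n⇒m<n∨m≡n)
open import Data.Product using (∃-syntax; _×_; _,_; proj₁; proj₂)
open import Data.Sum using (_⊎_; inj₁; inj₂; map₁)
open import Function using (id; _∘_)
open import Function.Bundles using (_⇔_; mk⇔)
open import Relation.Binary.Bundles using (Setoid)
import Relation.Binary.Reasoning.Setoid as SetoidReasoning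
open import Relation.Nullary using (Dec; yes; no)
open import Relation.Nullary.Decidable using (_→-dec_)
open import Relation.Binary.PropositionalEquality as ≡ using (_≡_; refl; sym; trans; cong; cong₂)

≡⇒≈ : ∀ {Γ σ} {M N : Tm Γ σ} → M ≡ N → M ≈ N
≡⇒≈ refl = ≈-refl

infix 4 _≗ʳ_ _≗ˢ_

_≗ʳ_ : ∀ {Γ Δ} → Ren Γ Δ → Ren Γ Δ → Set
_≗ʳ_ {Γ} r r' = ∀ {σ} (x : Γ ∋ σ) → r x ≡ r' x

_≗ˢ_ : ∀ {Γ Δ} → Sub Γ Δ → Sub Γ Δ → Set
_≗ˢ_ {Γ} γ γ' = ∀ {σ} (x : Γ ∋ σ) → γ x ≡ γ' x

ext-cong : ∀ {Γ Δ τ} {r r' : Ren Γ Δ} → r ≗ʳ r' → ext {τ = τ} r ≗ʳ ext r'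
ext-cong h Z     = refl
ext-cong h (S x) = cong S (h x)

rename-cong : ∀ {Γ Δ σ} {r r' : Ren Γ Δ} → r ≗ʳ r' → (M : Tm Γ σ) → rename r M ≡ rename r' M
rename-cong h (var x)   = cong var (h x)
rename-cong h (lam M)   = cong lam (rename-cong (ext-cong h) M)
rename-cong h (app M N) = cong₂ app (rename-cong h M) (rename-cong h N)
rename-cong h (Y σ)     = refl

exts-cong : ∀ {Γ Δ τ} {γ γ' : Sub Γ Δ} → γ ≗ˢ γ' → exts {τ = τ} γ ≗ˢ exts γ'
exts-cong h Z     = refl
exts-cong h (S x) = cong (rename S) (h x)

subst-cong : ∀ {Γ Δ σ} {γ γ' : Sub Γ Δ} → γ ≗ˢ γ' → (M : Tm Γ σ) → subst γ M ≡ subst γ' M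
subst-cong h (var x)   = h x
subst-cong h (lam M)   = cong lam (subst-cong (exts-cong h) M)
subst-cong h (app M N) = cong₂ app (subst-cong h M) (subst-cong h N)
subst-cong h (Y σ)     = refl

rename-id : ∀ {Γ σ} (M : Tm Γ σ) → rename id M ≡ M
rename-id (var x)   = refl
rename-id (lam M)   = cong lam (trans (rename-cong (λ { Z → refl ; (S x) → refl }) M) (rename-id M))
rename-id (app M N) = cong₂ app (rename-id M) (rename-id N)
rename-id (Y σ)     = refl

rename-rename : ∀ {Γ Δ Θ σ} (r : Ren Γ Δ) (r' : Ren Δ Θ) (M : Tm Γ σ) →
                rename r' (rename r M) ≡ rename (r' ∘ r) M
rename-rename r r' (var x)   = refl
rename-rename r r' (lam M)   =
  cong lam (trans (rename-rename (ext r) (ext r') M) (rename-cong (λ { Z → refl ; (S x) → refl }) M))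
rename-rename r r' (app M N) = cong₂ app (rename-rename r r' M) (rename-rename r r' N)
rename-rename r r' (Y σ)     = refl

rename-subst : ∀ {Γ Δ Θ σ} (γ : Sub Γ Δ) (r : Ren Δ Θ) (M : Tm Γ σ) →
               rename r (subst γ M) ≡ subst (rename r ∘ γ) M
rename-subst γ r (var x)   = refl
rename-subst γ r (lam M)   = cong lam (trans (rename-subst (exts γ) (ext r) M) (subst-cong exts-comm M))
  where
  exts-comm : rename (ext r) ∘ exts γ ≗ˢ exts (rename r ∘ γ)
  exts-comm Z     = refl
  exts-comm (S x) = trans (rename-rename S (ext r) (γ x)) (sym (rename-rename r S (γ x)))
rename-subst γ r (app M N) = cong₂ app (rename-subst γ r M) (rename-subst γ r N)
rename-subst γ r (Y σ)     = refl

subst-rename : ∀ {Γ Δ Θ σ} (r : Ren Γ Δ) (γ : Sub Δ Θ) (M : Tm Γ σ) →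
               subst γ (rename r M) ≡ subst (γ ∘ r) M
subst-rename r γ (var x)   = refl
subst-rename r γ (lam M)   =
  cong lam (trans (subst-rename (ext r) (exts γ) M) (subst-cong (λ { Z → refl ; (S x) → refl }) M))
subst-rename r γ (app M N) = cong₂ app (subst-rename r γ M) (subst-rename r γ N)
subst-rename r γ (Y σ)     = refl

subst-subst : ∀ {Γ Δ Θ σ} (γ : Sub Γ Δ) (γ' : Sub Δ Θ) (M : Tm Γ σ) →
              subst γ' (subst γ M) ≡ subst (subst γ' ∘ γ) M
subst-subst γ γ' (var x)   = refl
subst-subst γ γ' (lam M)   = cong lam (trans (subst-subst (exts γ) (exts γ') M) (subst-cong exts-comm M))
  where
  exts-comm : subst (exts γ') ∘ exts γ ≗ˢ exts (subst γ' ∘ γ)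
  exts-comm Z     = refl
  exts-comm (S x) = trans (subst-rename S (exts γ') (γ x)) (sym (rename-subst γ' S (γ x)))
subst-subst γ γ' (app M N) = cong₂ app (subst-subst γ γ' M) (subst-subst γ γ' N)
subst-subst γ γ' (Y σ)     = refl

subst-var : ∀ {Γ Δ σ} (r : Ren Γ Δ) (M : Tm Γ σ) → subst (var ∘ r) M ≡ rename r M
subst-var r (var x)   = refl
subst-var r (lam M)   = cong lam (trans (subst-cong (λ { Z → refl ; (S x) → refl }) M) (subst-var (ext r) M))
subst-var r (app M N) = cong₂ app (subst-var r M) (subst-var r N)
subst-var r (Y σ)     = refl

subst-id : ∀ {Γ σ} (M : Tm Γ σ) → subst var M ≡ M
subst-id M = trans (subst-var id M) (rename-id M)

rename-[] : ∀ {Γ Δ σ τ} (r : Ren Γ Δ) (M : Tm (σ ∷ Γ) τ) (N : Tm Γ σ) →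
            rename r (M [ N ]) ≡ rename (ext r) M [ rename r N ]
rename-[] r M N = begin
  rename r (M [ N ])                          ≡⟨ rename-subst (single N) r M ⟩
  subst (rename r ∘ single N) M               ≡⟨ subst-cong (λ { Z → refl ; (S x) → refl }) M ⟩
  subst (single (rename r N) ∘ ext r) M       ≡⟨ sym (subst-rename (ext r) (single (rename r N)) M) ⟩
  rename (ext r) M [ rename r N ]             ∎
  where open ≡.≡-Reasoning

infixr 5 _•_

_•_ : ∀ {Γ Δ σ} → Tm Δ σ → Sub Γ Δ → Sub (σ ∷ Γ) Δ
(N • γ) Z     = N
(N • γ) (S x) = γ x

rename-exts-[] : ∀ {Γ Δ Θ σ τ} (r : Ren Δ Θ) (γ : Sub Γ Δ) (N : Tm Θ σ) (M : Tm (σ ∷ Γ) τ) →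
                 rename (ext r) (subst (exts γ) M) [ N ] ≡ subst (N • (rename r ∘ γ)) M
rename-exts-[] r γ N M = begin
  rename (ext r) (subst (exts γ) M) [ N ]            ≡⟨ cong (subst (single N)) (rename-subst (exts γ) (ext r) M) ⟩
  subst (single N) (subst (rename (ext r) ∘ exts γ) M) ≡⟨ subst-subst _ (single N) M ⟩
  subst (subst (single N) ∘ rename (ext r) ∘ exts γ) M ≡⟨ subst-cong pointwise M ⟩
  subst (N • (rename r ∘ γ)) M                       ∎
  where
  open ≡.≡-Reasoning
  pointwise : subst (single N) ∘ rename (ext r) ∘ exts γ ≗ˢ N • (rename r ∘ γ)
  pointwise Z     = refl
  pointwise (S x) = begin
    subst (single N) (rename (ext r) (rename S (γ x))) ≡⟨ cong (subst (single N)) (rename-rename S (ext r) (γ x)) ⟩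
    subst (single N) (rename (S ∘ r) (γ x))            ≡⟨ subst-rename (S ∘ r) (single N) (γ x) ⟩
    subst (var ∘ r) (γ x)                              ≡⟨ subst-var r (γ x) ⟩
    rename r (γ x)                                     ∎

≈-rename : ∀ {Γ Δ σ} (r : Ren Γ Δ) {M N : Tm Γ σ} → M ≈ N → rename r M ≈ rename r N
≈-rename r (β {M = M} {N}) = ≈-trans β (≡⇒≈ (sym (rename-[] r M N)))
≈-rename r (η {M = M})     = ≈-trans (≡⇒≈ (cong (λ X → lam (app X (var Z))) wk-comm)) η
  where
  wk-comm : rename (ext r) (wk M) ≡ wk (rename r M)
  wk-comm = trans (rename-rename S (ext r) M) (sym (rename-rename r S M))
≈-rename r Yconv           = Yconv
≈-rename r ≈-refl          = ≈-refl
≈-rename r (≈-sym p)       = ≈-sym (≈-rename r p)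
≈-rename r (≈-trans p q)   = ≈-trans (≈-rename r p) (≈-rename r q)
≈-rename r (≈-lam p)       = ≈-lam (≈-rename (ext r) p)
≈-rename r (≈-app p q)     = ≈-app (≈-rename r p) (≈-rename r q)

mutual
  Nf-rename : ∀ {Γ Δ σ} (r : Ren Γ Δ) {M : Tm Γ σ} → Nf M → Nf (rename r M)
  Nf-rename r (nf-lam n) = nf-lam (Nf-rename (ext r) n)
  Nf-rename r (nf-ne n)  = nf-ne (Ne-rename r n)

  Ne-rename : ∀ {Γ Δ σ} (r : Ren Γ Δ) {M : Tm Γ σ} → Ne M → Ne (rename r M)
  Ne-rename r ne-var       = ne-var
  Ne-rename r (ne-app m n) = ne-app (Ne-rename r m) (Nf-rename r n)

record Eqv (σ : Ty) (x y : O σ) : Set where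
  constructor eqv
  field
    le : Le σ x y
    ge : Le σ y x

open Eqv

Eqv-refl : ∀ σ (x : O σ) → Eqv σ x x
Eqv-refl σ x = eqv (Le-refl σ x) (Le-refl σ x)

Eqv-sym : ∀ σ {x y : O σ} → Eqv σ x y → Eqv σ y x
Eqv-sym σ (eqv x≤y y≤x) = eqv y≤x x≤y

Eqv-trans : ∀ σ {x y z : O σ} → Eqv σ x y → Eqv σ y z → Eqv σ x z
Eqv-trans σ (eqv x≤y y≤x) (eqv y≤z z≤y) = eqv (Le-trans σ x≤y y≤z) (Le-trans σ z≤y y≤x)

O-setoid : Ty → Setoid _ _
O-setoid σ = record
  { Carrier       = O σ
  ; _≈_           = Eqv σ
  ; isEquivalence = record { refl = Eqv-refl σ _ ; sym = Eqv-sym σ ; trans = Eqv-trans σ }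
  }

Eqv-ext : ∀ σ τ {f g : O (σ ⇒ τ)} → (∀ x → Eqv τ (proj₁ f x) (proj₁ g x)) → Eqv (σ ⇒ τ) f g
Eqv-ext σ τ h = eqv (λ x → le (h x)) (λ x → ge (h x))

Eqv-app : ∀ σ τ {f g : O (σ ⇒ τ)} {x y : O σ} → Eqv (σ ⇒ τ) f g → Eqv σ x y →
          Eqv τ (proj₁ f x) (proj₁ g y)
Eqv-app σ τ {f} {g} {x} {y} (eqv f≤g g≤f) (eqv x≤y y≤x) =
  eqv (Le-trans τ (proj₂ f x≤y) (f≤g y)) (Le-trans τ (proj₂ g y≤x) (g≤f x))

⟦⟧-rename : ∀ {Γ Δ σ} (r : Ren Γ Δ) (M : Tm Γ σ) {ρ : Env Δ} {ρ' : Env Γ} →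
            (∀ {τ} (x : Γ ∋ τ) → Eqv τ (ρ (r x)) (ρ' x)) → Eqv σ (⟦ rename r M ⟧ ρ) (⟦ M ⟧ ρ')
⟦⟧-rename r (var x)           h = h x
⟦⟧-rename r (lam {σ} {τ} M)   h =
  Eqv-ext σ τ λ d → ⟦⟧-rename (ext r) M λ { Z → Eqv-refl σ d ; (S x) → h x }
⟦⟧-rename r (app {σ} {τ} M N) h = Eqv-app σ τ (⟦⟧-rename r M h) (⟦⟧-rename r N h)
⟦⟧-rename r (Y σ)             h = Eqv-refl ((σ ⇒ σ) ⇒ σ) (lfp σ)

⟦⟧-subst : ∀ {Γ Δ σ} (γ : Sub Γ Δ) (M : Tm Γ σ) {ρ : Env Δ} {ρ' : Env Γ} →
           (∀ {τ} (x : Γ ∋ τ) → Eqv τ (⟦ γ x ⟧ ρ) (ρ' x)) → Eqv σ (⟦ subst γ M ⟧ ρ) (⟦ M ⟧ ρ')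
⟦⟧-subst γ (var x)           h = h x
⟦⟧-subst γ (lam {σ} {τ} M) {ρ} h = Eqv-ext σ τ λ d → ⟦⟧-subst (exts γ) M λ
  { Z     → Eqv-refl σ d
  ; (S {σ = τ'} x) → Eqv-trans τ' (⟦⟧-rename S (γ x) (λ {υ} y → Eqv-refl υ (ρ y))) (h x) }
⟦⟧-subst γ (app {σ} {τ} M N) h = Eqv-app σ τ (⟦⟧-subst γ M h) (⟦⟧-subst γ N h)
⟦⟧-subst γ (Y σ)             h = Eqv-refl ((σ ⇒ σ) ⇒ σ) (lfp σ)

record Enum (σ : Ty) : Set where
  field
    el       : Fin (card σ) → O σ
    index    : O σ → Fin (card σ)
    el-index : ∀ x → Eqv σ (el (index x)) x
    _≤?_     : ∀ x y → Dec (Le σ x y)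

enum-o : Enum o
enum-o = record { el = el ; index = index ; el-index = el-index ; _≤?_ = _≤?_ }
  where
  el : Fin 2 → Bool
  el zero    = false
  el (suc _) = true
  index : Bool → Fin 2
  index false = zero
  index true  = suc zero
  el-index : ∀ x → Eqv o (el (index x)) x
  el-index false = Eqv-refl o false
  el-index true  = Eqv-refl o true
  _≤?_ : ∀ x y → Dec (x ≤B y)
  false ≤? y     = yes f≤
  true  ≤? true  = yes t≤t
  true  ≤? false = no λ ()

-- A function is coded by the table of indices of its values on the
-- representatives of O σ; codes of non-monotone tables decode to ⊥.
module EnumArrow {σ τ : Ty} (Eσ : Enum σ) (Eτ : Enum τ) where
  private
    module A = Enum Eσ
    module B = Enum Eτ

  Table : Set
  Table = Fin (card σ) → Fin (card τ)

  Monotone : Table → Set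
  Monotone c = ∀ i j → Le σ (A.el i) (A.el j) → Le τ (B.el (c i)) (B.el (c j))

  monotone? : ∀ c → Dec (Monotone c)
  monotone? c = all? λ i → all? λ j → A.el i A.≤? A.el j →-dec B.el (c i) B.≤? B.el (c j)

  decode : Table → O (σ ⇒ τ)
  decode c with monotone? c
  ... | yes mono = (λ y → B.el (c (A.index y))) ,
                   λ {y} {y'} y≤y' → mono _ _ (Le-trans σ (le (A.el-index y))
                                                (Le-trans σ y≤y' (ge (A.el-index y'))))
  ... | no _     = bot (σ ⇒ τ)

  decode-monotone : ∀ c → Monotone c → ∀ y → Eqv τ (proj₁ (decode c) y) (B.el (c (A.index y)))
  decode-monotone c mono y with monotone? c
  ... | yes _     = Eqv-refl τ _
  ... | no ¬mono  = ⊥-elim (¬mono mono)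

  table : O (σ ⇒ τ) → Table
  table f i = B.index (proj₁ f (A.el i))

  table-monotone : ∀ f → Monotone (finToFun (funToFin (table f)))
  table-monotone f i j p
    rewrite finToFun-funToFin (table f) i | finToFun-funToFin (table f) j =
    Le-trans τ (le (B.el-index _)) (Le-trans τ (proj₂ f p) (ge (B.el-index _)))

  decode-table : ∀ f y → Eqv τ (proj₁ (decode (finToFun (funToFin (table f)))) y) (proj₁ f y)
  decode-table f y = begin
    proj₁ (decode (finToFun (funToFin (table f)))) y ≈⟨ decode-monotone _ (table-monotone f) y ⟩
    B.el (finToFun (funToFin (table f)) (A.index y)) ≡⟨ cong B.el (finToFun-funToFin (table f) (A.index y)) ⟩
    B.el (B.index (proj₁ f (A.el (A.index y))))      ≈⟨ B.el-index _ ⟩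
    proj₁ f (A.el (A.index y))                       ≈⟨ Eqv-app σ τ (Eqv-refl (σ ⇒ τ) f) (A.el-index y) ⟩
    proj₁ f y                                        ∎
    where open SetoidReasoning (O-setoid τ)

  _≤?_ : ∀ f g → Dec (Le (σ ⇒ τ) f g)
  f ≤? g with all? (λ i → proj₁ f (A.el i) B.≤? proj₁ g (A.el i))
  ... | yes f≤g = yes λ y → Le-trans τ (proj₂ f (ge (A.el-index y)))
                              (Le-trans τ (f≤g (A.index y)) (proj₂ g (le (A.el-index y))))
  ... | no f≰g  = no λ f≤g → f≰g (λ i → f≤g (A.el i))

  enum-⇒ : Enum (σ ⇒ τ)
  enum-⇒ = record
    { el       = decode ∘ finToFun
    ; index    = funToFin ∘ table
    ; el-index = λ f → Eqv-ext σ τ (decode-table f)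
    ; _≤?_     = _≤?_
    }

enum : ∀ σ → Enum σ
enum o       = enum-o
enum (σ ⇒ τ) = EnumArrow.enum-⇒ (enum σ) (enum τ)

bot-least : ∀ σ (x : O σ) → Le σ (bot σ) x
bot-least o       x = f≤
bot-least (σ ⇒ τ) f x = bot-least τ (proj₁ f x)

iter-inc : ∀ σ (g : O (σ ⇒ σ)) n → Le σ (iter σ n g) (iter σ (suc n) g)
iter-inc σ g zero    = bot-least σ _
iter-inc σ g (suc n) = proj₂ g (iter-inc σ g n)

sum-mono-≤ : ∀ {n} {f g : Fin n → ℕ} → (∀ i → f i ≤ g i) → sum f ≤ sum g
sum-mono-≤ {zero}  f≤g = z≤n
sum-mono-≤ {suc n} f≤g = +-mono-≤ (f≤g zero) (sum-mono-≤ (f≤g ∘ suc))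

sum-mono-< : ∀ {n} {f g : Fin n → ℕ} → (∀ i → f i ≤ g i) → ∀ i → f i < g i → sum f < sum g
sum-mono-< f≤g zero    fi<gi = +-mono-<-≤ fi<gi (sum-mono-≤ (f≤g ∘ suc))
sum-mono-< f≤g (suc i) fi<gi = +-mono-≤-< (f≤g zero) (sum-mono-< (f≤g ∘ suc) i fi<gi)

sum-≤-* : ∀ {n k} {f : Fin n → ℕ} → (∀ i → f i ≤ k) → sum f ≤ n * k
sum-≤-* {zero}  f≤k = z≤n
sum-≤-* {suc n} f≤k = +-mono-≤ (f≤k zero) (sum-≤-* (f≤k ∘ suc))

rank : ∀ σ → O σ → ℕ
rank o       false = 0
rank o       true  = 1
rank (σ ⇒ τ) f     = sum λ i → rank τ (proj₁ f (Enum.el (enum σ) i))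

rank-mono : ∀ σ {x y} → Le σ x y → rank σ x ≤ rank σ y
rank-mono o       {y = false} f≤  = z≤n
rank-mono o       {y = true}  f≤  = z≤n
rank-mono o                   t≤t = ≤-refl
rank-mono (σ ⇒ τ)             f≤g = sum-mono-≤ λ i → rank-mono τ (f≤g (Enum.el (enum σ) i))

rank-≡⇒≥ : ∀ σ {x y} → Le σ x y → rank σ x ≡ rank σ y → Le σ y x
rank-≡⇒≥ o {y = false} f≤  _  = f≤
rank-≡⇒≥ o {y = true}  f≤  ()
rank-≡⇒≥ o             t≤t _  = t≤t
rank-≡⇒≥ (σ ⇒ τ) {f} {g} f≤g rank≡ y =
  Le-trans τ (proj₂ g (ge (el-index y)))
    (Le-trans τ (on-representatives (index y)) (proj₂ f (le (el-index y))))
  where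
  open Enum (enum σ)
  -- a strict increase at one representative would make the sums differ
  on-representatives : ∀ i → Le τ (proj₁ g (el i)) (proj₁ f (el i))
  on-representatives i with m≤n⇒m<n∨m≡n (rank-mono τ (f≤g (el i)))
  ... | inj₂ rank≡ᵢ = rank-≡⇒≥ τ (f≤g _) rank≡ᵢ
  ... | inj₁ rank<ᵢ = ⊥-elim (<⇒≢ (sum-mono-< (λ j → rank-mono τ (f≤g (el j))) i rank<ᵢ) rank≡)

rank-<⊎≥ : ∀ σ {x y} → Le σ x y → rank σ x < rank σ y ⊎ Le σ y x
rank-<⊎≥ σ x≤y with m≤n⇒m<n∨m≡n (rank-mono σ x≤y)
... | inj₁ rank< = inj₁ rank<
... | inj₂ rank≡ = inj₂ (rank-≡⇒≥ σ x≤y rank≡)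

rank≤height : ∀ σ x → rank σ x ≤ height σ
rank≤height o       false = z≤n
rank≤height o       true  = ≤-refl
rank≤height (σ ⇒ τ) f     = sum-≤-* λ i → rank≤height τ (proj₁ f (Enum.el (enum σ) i))

module _ (σ : Ty) (g : O (σ ⇒ σ)) where
  private
    chain : ℕ → O σ
    chain n = iter σ n g

    grows-or-stable : ∀ n → n ≤ rank σ (chain n) →
                      suc n ≤ rank σ (chain (suc n)) ⊎ Le σ (chain (suc n)) (chain n)
    grows-or-stable n n≤rank = map₁ (≤-<-trans n≤rank) (rank-<⊎≥ σ (iter-inc σ g n))

  kleene-grows-or-stable : ∀ n → suc n ≤ rank σ (chain (suc n)) ⊎ Le σ (chain (suc n)) (chain n)
  kleene-grows-or-stable zero    = grows-or-stable zero z≤n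
  kleene-grows-or-stable (suc n) with kleene-grows-or-stable n
  ... | inj₁ grown  = grows-or-stable (suc n) grown
  ... | inj₂ stable = inj₂ (proj₂ g stable)

  kleene-stable : Le σ (chain (suc (height σ))) (chain (height σ))
  kleene-stable with kleene-grows-or-stable (height σ)
  ... | inj₁ grown  = ⊥-elim (<⇒≱ grown (rank≤height σ _))
  ... | inj₂ stable = stable

lfp-unfold : ∀ σ (g : O (σ ⇒ σ)) → Eqv σ (proj₁ g (proj₁ (lfp σ) g)) (proj₁ (lfp σ) g)
lfp-unfold σ g = eqv (kleene-stable σ g) (iter-inc σ g (height σ))

≈⇒Eqv : ∀ {Γ σ} {M N : Tm Γ σ} → M ≈ N → (ρ : Env Γ) → Eqv σ (⟦ M ⟧ ρ) (⟦ N ⟧ ρ)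
≈⇒Eqv (β {σ} {τ} {M} {N}) ρ =
  Eqv-sym τ (⟦⟧-subst (single N) M λ { Z → Eqv-refl σ (⟦ N ⟧ ρ) ; (S {σ = υ} x) → Eqv-refl υ (ρ x) })
≈⇒Eqv (η {σ} {τ} {M}) ρ =
  Eqv-ext σ τ λ d → Eqv-app σ τ (⟦⟧-rename S M λ {υ} x → Eqv-refl υ (ρ x)) (Eqv-refl σ d)
≈⇒Eqv (Yconv {σ} {f}) ρ = lfp-unfold σ (⟦ f ⟧ ρ)
≈⇒Eqv ≈-refl              ρ = Eqv-refl _ _
≈⇒Eqv (≈-sym p)           ρ = Eqv-sym _ (≈⇒Eqv p ρ)
≈⇒Eqv (≈-trans p q)       ρ = Eqv-trans _ (≈⇒Eqv p ρ) (≈⇒Eqv q ρ)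
≈⇒Eqv (≈-lam {σ} {τ} p)   ρ = Eqv-ext σ τ λ d → ≈⇒Eqv p (extend ρ d)
≈⇒Eqv (≈-app {σ} {τ} p q) ρ = Eqv-app σ τ (≈⇒Eqv p ρ) (≈⇒Eqv q ρ)

true-≤B : ∀ {b c} → b ≡ true → b ≤B c → c ≡ true
true-≤B refl t≤t = refl

meet-≤ : ∀ τ b (y : O τ) → Le τ (meet τ b y) y
meet-≤ o       false y = f≤
meet-≤ o       true  y = Le-refl o y
meet-≤ (σ ⇒ τ) b     f x = meet-≤ τ b (proj₁ f x)

meet-true-≥ : ∀ τ (y : O τ) → Le τ y (meet τ true y)
meet-true-≥ o       y   = Le-refl o y
meet-true-≥ (σ ⇒ τ) f x = meet-true-≥ τ (proj₁ f x)

meet-false-≤ : ∀ τ (y z : O τ) → Le τ (meet τ false y) z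
meet-false-≤ o       y z   = f≤
meet-false-≤ (σ ⇒ τ) f g x = meet-false-≤ τ (proj₁ f x) (proj₁ g x)

s-app-≥ : ∀ σ τ {x} → t σ x ≡ true → Le τ (s τ) (proj₁ (s (σ ⇒ τ)) x)
s-app-≥ σ τ tx rewrite tx = meet-true-≥ τ (s τ)

s-⇒-≤ : ∀ σ τ (f : O (σ ⇒ τ)) → (∀ x → t σ x ≡ true → Le τ (s τ) (proj₁ f x)) →
        Le (σ ⇒ τ) (s (σ ⇒ τ)) f
s-⇒-≤ σ τ f h x with t σ x in tx
... | false = meet-false-≤ τ (s τ) (proj₁ f x)
... | true  = Le-trans τ (meet-≤ τ true (s τ)) (h x tx)

mutual
  t-s : ∀ σ → t σ (s σ) ≡ true
  t-s o       = refl
  t-s (σ ⇒ τ) = s≤⇒t≡true τ (s-app-≥ σ τ (t-s σ))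

  s≤⇒t≡true : ∀ σ {d} → Le σ (s σ) d → t σ d ≡ true
  s≤⇒t≡true σ s≤d = true-≤B (t-s σ) (t-mono σ s≤d)

t≡true⇒s≤ : ∀ σ d → t σ d ≡ true → Le σ (s σ) d
t≡true⇒s≤ o       true refl = t≤t
t≡true⇒s≤ (σ ⇒ τ) f  tf   =
  s-⇒-≤ σ τ f λ x tx → Le-trans τ (t≡true⇒s≤ τ _ tf) (proj₂ f (t≡true⇒s≤ σ x tx))

Above-s : ∀ {Γ} → Env Γ → Set
Above-s {Γ} ρ = ∀ {σ} (x : Γ ∋ σ) → Le σ (s σ) (ρ x)

mutual
  Nf⇒s≤⟦⟧ : ∀ {Γ σ} {N : Tm Γ σ} → Nf N → (ρ : Env Γ) → Above-s ρ → Le σ (s σ) (⟦ N ⟧ ρ)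
  Nf⇒s≤⟦⟧ (nf-lam {σ} {τ} {M} nf) ρ h = s-⇒-≤ σ τ (⟦ lam M ⟧ ρ) λ d td →
    Nf⇒s≤⟦⟧ nf (extend ρ d) λ { Z → t≡true⇒s≤ σ d td ; (S x) → h x }
  Nf⇒s≤⟦⟧ (nf-ne ne)               ρ h = Ne⇒s≤⟦⟧ ne ρ h

  Ne⇒s≤⟦⟧ : ∀ {Γ σ} {N : Tm Γ σ} → Ne N → (ρ : Env Γ) → Above-s ρ → Le σ (s σ) (⟦ N ⟧ ρ)
  Ne⇒s≤⟦⟧ (ne-var {x = x})                 ρ h = h x
  Ne⇒s≤⟦⟧ (ne-app {σ} {τ} {N = N} ne nf) ρ h =
    Le-trans τ (s-app-≥ σ τ (s≤⇒t≡true σ (Nf⇒s≤⟦⟧ nf ρ h))) (Ne⇒s≤⟦⟧ ne ρ h (⟦ N ⟧ ρ))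

HasNf : ∀ {Γ σ} → Tm Γ σ → Set
HasNf M = ∃[ N ] (Nf N × M ≈ N)

infix 4 _⊩_

_⊩_ : ∀ {Γ σ} → Tm Γ σ → O σ → Set
_⊩_ {σ = o}     M b = b ≡ true → HasNf M
_⊩_ {Γ} {σ ⇒ τ} M f =
  ∀ {Δ} (r : Ren Γ Δ) {N : Tm Δ σ} {e : O σ} → N ⊩ e → app (rename r M) N ⊩ proj₁ f e

⊩-≈ : ∀ {Γ σ} {M M' : Tm Γ σ} {d : O σ} → M ≈ M' → M ⊩ d → M' ⊩ d
⊩-≈ {σ = o}     M≈M' M⊩ b≡true with M⊩ b≡true
... | N , nf , M≈N = N , nf , ≈-trans (≈-sym M≈M') M≈N
⊩-≈ {σ = σ ⇒ τ} M≈M' M⊩ r N⊩ = ⊩-≈ (≈-app (≈-rename r M≈M') ≈-refl) (M⊩ r N⊩)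

⊩-≤ : ∀ {Γ σ} {M : Tm Γ σ} {d d' : O σ} → Le σ d' d → M ⊩ d → M ⊩ d'
⊩-≤ {σ = o}     t≤t     M⊩ = M⊩
⊩-≤ {σ = o}     f≤      M⊩ = λ ()
⊩-≤ {σ = σ ⇒ τ} d'≤d    M⊩ r N⊩ = ⊩-≤ (d'≤d _) (M⊩ r N⊩)

⊩-bot : ∀ {Γ σ} (M : Tm Γ σ) → M ⊩ bot σ
⊩-bot {σ = o}     M      = λ ()
⊩-bot {σ = σ ⇒ τ} M r N⊩ = ⊩-bot _

⊩-rename : ∀ {Γ Δ σ} (r : Ren Γ Δ) {M : Tm Γ σ} {d : O σ} → M ⊩ d → rename r M ⊩ d
⊩-rename {σ = o}     r M⊩ b≡true with M⊩ b≡true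
... | N , nf , M≈N = rename r N , Nf-rename r nf , ≈-rename r M≈N
⊩-rename {σ = σ ⇒ τ} r {M} M⊩ r' N⊩ =
  ⊩-≈ (≈-app (≡⇒≈ (sym (rename-rename r r' M))) ≈-refl) (M⊩ (r' ∘ r) N⊩)

mutual
  reflect : ∀ {Γ} σ {M : Tm Γ σ} → Ne M → M ⊩ s σ
  reflect o       {M} ne _ = M , nf-ne ne , ≈-refl
  reflect (σ ⇒ τ) ne r {N} {e} N⊩ with t σ e in te
  ... | false = ⊩-≤ (meet-false-≤ τ (s τ) (bot τ)) (⊩-bot _)
  ... | true with reify σ N⊩ te
  ...   | N' , nf , N≈N' = ⊩-≈ (≈-app ≈-refl (≈-sym N≈N'))
                             (⊩-≤ (meet-≤ τ true (s τ)) (reflect τ (ne-app (Ne-rename r ne) nf)))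

  reify : ∀ {Γ} σ {M : Tm Γ σ} {d : O σ} → M ⊩ d → t σ d ≡ true → HasNf M
  reify o       M⊩ td = M⊩ td
  reify (σ ⇒ τ) M⊩ td with reify τ (M⊩ S (reflect σ (ne-var {x = Z}))) td
  ... | N , nf , M·x≈N = lam N , nf-lam nf , ≈-trans (≈-sym η) (≈-lam M·x≈N)

⊩-Y : ∀ {Δ σ} {f : Tm Δ (σ ⇒ σ)} {g : O (σ ⇒ σ)} → f ⊩ g → ∀ n → app (Y σ) f ⊩ iter σ n g
⊩-Y f⊩ zero    = ⊩-bot _
⊩-Y {f = f} f⊩ (suc n) = ⊩-≈ (≈-trans (≈-app (≡⇒≈ (rename-id f)) ≈-refl) Yconv) (f⊩ id (⊩-Y f⊩ n))

⊩-⟦⟧ : ∀ {Γ Δ σ} (M : Tm Γ σ) (γ : Sub Γ Δ) (ρ : Env Γ) →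
       (∀ {τ} (x : Γ ∋ τ) → γ x ⊩ ρ x) → subst γ M ⊩ ⟦ M ⟧ ρ
⊩-⟦⟧ (var x)   γ ρ γ⊩ρ = γ⊩ρ x
⊩-⟦⟧ (app M N) γ ρ γ⊩ρ =
  ⊩-≈ (≈-app (≡⇒≈ (rename-id _)) ≈-refl) (⊩-⟦⟧ M γ ρ γ⊩ρ id (⊩-⟦⟧ N γ ρ γ⊩ρ))
⊩-⟦⟧ (lam M)   γ ρ γ⊩ρ r {N} {e} N⊩e =
  ⊩-≈ (≈-sym (≈-trans β (≡⇒≈ (rename-exts-[] r γ N M))))
      (⊩-⟦⟧ M (N • (rename r ∘ γ)) (extend ρ e) λ { Z → N⊩e ; (S x) → ⊩-rename r (γ⊩ρ x) })
⊩-⟦⟧ (Y σ)     γ ρ γ⊩ρ r f⊩g = ⊩-Y f⊩g (height σ)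

fact2 : ∀ {σ} (M : Tm [] σ) →
    (∃[ N ] (Nf N × M ≈ N)) ⇔ (t σ (⟦ M ⟧ emptyEnv) ≡ true)
fact2 {σ} M = mk⇔ sound complete
  where
  sound : HasNf M → t σ (⟦ M ⟧ emptyEnv) ≡ true
  sound (N , nf , M≈N) =
    s≤⇒t≡true σ (Le-trans σ (Nf⇒s≤⟦⟧ nf emptyEnv (λ ())) (ge (≈⇒Eqv M≈N emptyEnv)))

  complete : t σ (⟦ M ⟧ emptyEnv) ≡ true → HasNf M
  complete = reify σ (≡.subst (_⊩ ⟦ M ⟧ emptyEnv) (subst-id M) (⊩-⟦⟧ M var emptyEnv (λ ())))
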